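{- Let $n\ge 4$ be an integer with $n\equiv 0\pmod 4$. Then $\xi(C_n\square K_2)=n$.
   Context: All graphs are finite, simple, connected and undirected; $d_G(u,v)$ is the shortest-path distance. A set $D\subseteq V(G)$ is a distance-equalizer set of $G$ if for any two vertices $x,y\in V(G)\setminus D$ there is $w\in D$ with $d_G(x,w)=d_G(y,w)$. The equidistant dimension $\xi(G)$ is the minimum cardinality of a distance-equalizer set of $G$. $C_n$ is the cycle on $n$ vertices and $K_2$ the complete graph on two vertices. The Cartesian product $G\square H$ has vertex set $V(G)\times V(H)$, with $(g,h)\sim(g',h')$ iff either $g=g'$ and $hh'\in E(H)$, or $h=h'$ and $gg'\in E(G)$. -}

module Defs where

open import Level using (0ℓ)
open import Data.Nat using (ℕ; zero; suc; _≤_; _%_)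
open import Data.Fin using (Fin; toℕ)
open import Data.Sum using (_⊎_)
open import Data.Product using (_×_; Σ; ∃; ∃-syntax; _,_)
open import Data.List using (List; length)
open import Data.List.Membership.Propositional using (_∈_; _∉_)
open import Data.List.Relation.Unary.Unique.Propositional using (Unique)
open import Relation.Binary.PropositionalEquality using (_≡_; _≢_)

record Graph : Set₁ where
  field
    V   : Set
    Adj : V → V → Set
open Graph public

data Walk (G : Graph) : V G → V G → ℕ → Set where
  here : ∀ {x} → Walk G x x zero
  step : ∀ {x y z k} → Adj G x y → Walk G y z k → Walk G x z (suc k)

Dist : (G : Graph) → V G → V G → ℕ → Set
Dist G x y k = Walk G x y k × (∀ m → Walk G x y m → k ≤ m)

IsDistanceEqualizer : (G : Graph) → List (V G) → Set
IsDistanceEqualizer G D =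
  ∀ x y → x ∉ D → y ∉ D → x ≢ y →
    ∃[ w ] (w ∈ D × ∃[ k ] (Dist G x w k × Dist G y w k))

-- ξ(G) = k : k is the minimum cardinality of a distance-equalizer set
-- (sets represented as duplicate-free lists).
EquidistantDimension : Graph → ℕ → Set
EquidistantDimension G k =
  (∃[ D ] (Unique D × IsDistanceEqualizer G D × length D ≡ k))
  × (∀ D → Unique D → IsDistanceEqualizer G D → k ≤ length D)

-- Cycle C_n on vertices 0..n-1: i ~ j iff j = i+1 (mod n), or symmetrically.
-- (For n ≥ 3 this is the simple cycle C_n.)
Succ : (n : ℕ) → Fin n → Fin n → Set
Succ n i j = (toℕ j ≡ suc (toℕ i)) ⊎ (suc (toℕ i) ≡ n × toℕ j ≡ 0)

Cycle : ℕ → Graph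
Cycle n = record { V = Fin n ; Adj = λ i j → Succ n i j ⊎ Succ n j i }

K2 : Graph
K2 = record { V = Fin 2 ; Adj = λ i j → i ≢ j }

_□_ : Graph → Graph → Graph
G □ H = record
  { V   = V G × V H
  ; Adj = λ { (g , h) (g′ , h′) → (g ≡ g′ × Adj H h h′) ⊎ (h ≡ h′ × Adj G g g′) } }

-- The prism is bipartite, so two adjacent vertices are never equidistant from a third one;
-- hence a distance-equalizer set meets each of the n rungs {(i,0),(i,1)} and has at least n
-- elements. Conversely, let D be one colour class. A vertex outside D lies at odd distance from
-- each (k, b) ∈ D, and that distance is c or c + 1 for the cyclic distance c between the
-- positions, so it equals 2⌊c/2⌋ + 1. It remains to find, for positions I and J on C_n, a position
-- K whose cyclic distances to I and J have equal halves: the midpoint of an arc between I and J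
-- of even length, or else the point splitting an arc of length 4s + 1 into 2s and 2s + 1; since
-- 4 ∣ n, one of the two arcs between I and J has such a length.

module Submission where

open import Function.Base using (_∘_)
open import Data.Empty using (⊥; ⊥-elim)
open import Data.Sum using (_⊎_; inj₁; inj₂)
open import Data.Product using (_×_; ∃-syntax; ∃₂; _,_; proj₁; proj₂; swap)
open import Data.Product.Properties using (≡-dec)
open import Data.Nat using (ℕ; zero; suc; _+_; _*_; _∸_; _≤_; _<_; _⊓_; ∣_-_∣; ⌊_/2⌋; z≤n; s≤s; s≤s⁻¹; _%_; parity)
open import Data.Nat.Properties
open import Data.Nat.Divisibility using (_∣_; divides; m%n≡0⇒n∣m)
open import Data.Nat.Tactic.RingSolver using (solve-∀; solve)
open import Data.Parity.Base using (Parity; 0ℙ; 1ℙ; _⁻¹) renaming (_+_ to _⊕_)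
import Data.Parity.Properties as ℙ
open import Data.Fin using (Fin; toℕ; fromℕ; fromℕ<) renaming (zero to fzero; suc to fsuc)
open import Data.Fin.Properties using (toℕ-injective; toℕ-fromℕ<; toℕ-fromℕ; toℕ<n; injective⇒≤) renaming (_≟_ to _≟ᶠ_)
open import Data.List using (List; _∷_; []; map; allFin; length; lookup)
open import Data.List.Properties using (length-map; length-tabulate)
open import Data.List.Membership.Propositional using (_∈_; _∉_)
open import Data.List.Membership.Propositional.Properties using (∈-map⁺; ∈-allFin)
import Data.List.Membership.DecPropositional as DecMembership
open import Data.List.Relation.Unary.Any using (index)
open import Data.List.Relation.Unary.Any.Properties using (lookup-index)
open import Data.List.Relation.Unary.Unique.Propositional using (Unique)
open import Data.List.Relation.Unary.Unique.Propositional.Properties using (map⁺; allFin⁺)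
open import Relation.Nullary using (Dec; yes; no)
open import Relation.Binary.Definitions using (DecidableEquality)
open import Relation.Binary.PropositionalEquality

open import Defs

module _ {G : Graph} where

  _++ʷ_ : ∀ {x y z m k} → Walk G x y m → Walk G y z k → Walk G x z (m + k)
  here ++ʷ q = q
  step a p ++ʷ q = step a (p ++ʷ q)

  reverseʷ : (∀ {x y} → Adj G x y → Adj G y x) → ∀ {x y m} → Walk G x y m → Walk G y x m
  reverseʷ sym-adj here = here
  reverseʷ sym-adj (step {k = m} a p) =
    subst (Walk G _ _) (+-comm m 1) (reverseʷ sym-adj p ++ʷ step (sym-adj a) here)

  walk-length-≥ : (f : V G → ℕ) → (∀ {u v} → Adj G u v → f u ≤ suc (f v)) →
                  ∀ {u v m} → Walk G u v m → f u ≤ m + f v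
  walk-length-≥ f lip here = ≤-refl
  walk-length-≥ f lip (step a p) = ≤-trans (lip a) (s≤s (walk-length-≥ f lip p))

p⁻¹+q≡[p+q]⁻¹ : ∀ p q → p ⁻¹ ⊕ q ≡ (p ⊕ q) ⁻¹
p⁻¹+q≡[p+q]⁻¹ = ℙ.+-assoc 1ℙ

p+q⁻¹≡[p+q]⁻¹ : ∀ p q → p ⊕ q ⁻¹ ≡ (p ⊕ q) ⁻¹
p+q⁻¹≡[p+q]⁻¹ 0ℙ q = refl
p+q⁻¹≡[p+q]⁻¹ 1ℙ q = refl

IsBipartition : (G : Graph) → (V G → Parity) → Set
IsBipartition G side = ∀ {x y} → Adj G x y → side y ≡ side x ⁻¹

module _ {G : Graph} {side : V G → Parity} (bip : IsBipartition G side) where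

  walk-parity : ∀ {x y m} → Walk G x y m → parity m ≡ side x ⊕ side y
  walk-parity {x} here = sym (ℙ.p+p≡0ℙ (side x))
  walk-parity {x} (step {y = y} {z} {k = m} a p) = begin
    parity (suc m)            ≡⟨ ℙ.+-homo-+ 1 m ⟩
    parity m ⁻¹               ≡⟨ cong _⁻¹ (walk-parity p) ⟩
    (side y ⊕ side z) ⁻¹      ≡⟨ cong (λ s → (s ⊕ side z) ⁻¹) (bip a) ⟩
    (side x ⁻¹ ⊕ side z) ⁻¹   ≡⟨ cong _⁻¹ (p⁻¹+q≡[p+q]⁻¹ (side x) (side z)) ⟩
    (side x ⊕ side z) ⁻¹ ⁻¹   ≡⟨ ℙ.⁻¹-involutive _ ⟩
    side x ⊕ side z           ∎
    where open ≡-Reasoning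

  adjacent-not-equidistant : ∀ {x y w k} → Adj G x y → Walk G x w k → Walk G y w k → ⊥
  adjacent-not-equidistant {x} {y} {w} {k} a p q = ℙ.p≢p⁻¹ (side x) (ℙ.+-cancelʳ-≡ (side w) _ _ (begin
    side x ⊕ side w    ≡⟨ sym (walk-parity p) ⟩
    parity k           ≡⟨ walk-parity q ⟩
    side y ⊕ side w    ≡⟨ cong (_⊕ side w) (bip a) ⟩
    side x ⁻¹ ⊕ side w ∎))
    where open ≡-Reasoning

  adjacent-distinct : ∀ {x y} → Adj G x y → x ≢ y
  adjacent-distinct {x} a refl = ℙ.p≢p⁻¹ (side x) (bip a)

  equalizer-meets-edge : DecidableEquality (V G) → ∀ {D} → IsDistanceEqualizer G D →
                         ∀ {x y} → Adj G x y → x ∈ D ⊎ y ∈ D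
  equalizer-meets-edge _≟_ {D} equalizer {x} {y} a with x ∈? D | y ∈? D
    where open DecMembership _≟_ using (_∈?_)
  ... | yes x∈D | _       = inj₁ x∈D
  ... | no _    | yes y∈D = inj₂ y∈D
  ... | no x∉D  | no y∉D  with equalizer x y x∉D y∉D (adjacent-distinct a)
  ...   | _ , _ , _ , (p , _) , (q , _) = ⊥-elim (adjacent-not-equidistant a p q)

module _ {G H : Graph} where

  □-walkˡ : ∀ {g g′ h m} → Walk G g g′ m → Walk (G □ H) (g , h) (g′ , h) m
  □-walkˡ here       = here
  □-walkˡ (step e p) = step (inj₂ (refl , e)) (□-walkˡ p)

  □-walkʳ : ∀ {g h h′ m} → Walk H h h′ m → Walk (G □ H) (g , h) (g , h′) m
  □-walkʳ here       = here
  □-walkʳ (step e p) = step (inj₁ (refl , e)) (□-walkʳ p)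

  □-walk-split : ∀ {g g′ h h′ m} → Walk (G □ H) (g , h) (g′ , h′) m →
                 ∃₂ λ a b → Walk G g g′ a × Walk H h h′ b × a + b ≡ m
  □-walk-split here = 0 , 0 , here , here , refl
  □-walk-split (step (inj₁ (refl , e)) p) with □-walk-split p
  ... | a , b , p₁ , p₂ , a+b≡m = a , suc b , p₁ , step e p₂ , trans (+-suc a b) (cong suc a+b≡m)
  □-walk-split (step (inj₂ (refl , e)) p) with □-walk-split p
  ... | a , b , p₁ , p₂ , a+b≡m = suc a , b , step e p₁ , p₂ , cong suc a+b≡m

  Dist-□ : ∀ {g g′ h h′ a b} → Dist G g g′ a → Dist H h h′ b →
           Dist (G □ H) (g , h) (g′ , h′) (a + b)
  Dist-□ (p , p-min) (q , q-min) = □-walkˡ p ++ʷ □-walkʳ q , minimal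
    where
    minimal : ∀ m → Walk (G □ H) _ _ m → _ ≤ m
    minimal m r with □-walk-split r
    ... | a , b , r₁ , r₂ , a+b≡m = subst (_ ≤_) a+b≡m (+-mono-≤ (p-min a r₁) (q-min b r₂))

  □-bipartition : ∀ s t → IsBipartition G s → IsBipartition H t →
                  IsBipartition (G □ H) (λ v → s (proj₁ v) ⊕ t (proj₂ v))
  □-bipartition s t bipG bipH {g , h} (inj₁ (refl , e)) =
    trans (cong (s g ⊕_) (bipH e)) (p+q⁻¹≡[p+q]⁻¹ (s g) (t h))
  □-bipartition s t bipG bipH {g , h} (inj₂ (refl , e)) =
    trans (cong (_⊕ t h) (bipG e)) (p⁻¹+q≡[p+q]⁻¹ (s g) (t h))

K2-bipartition : IsBipartition K2 (parity ∘ toℕ)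
K2-bipartition {fzero}      {fzero}      0≢0 = ⊥-elim (0≢0 refl)
K2-bipartition {fzero}      {fsuc fzero} _   = refl
K2-bipartition {fsuc fzero} {fzero}      _   = refl
K2-bipartition {fsuc fzero} {fsuc fzero} 1≢1 = ⊥-elim (1≢1 refl)

K2-distance : ∀ a b → ∃[ d ] d ≤ 1 × Dist K2 a b d
K2-distance a b with a ≟ᶠ b
... | yes refl = 0 , z≤n , here , λ _ _ → z≤n
... | no a≢b   = 1 , ≤-refl , step a≢b here , minimal
  where
  minimal : ∀ m → Walk K2 a b m → 1 ≤ m
  minimal zero    here = ⊥-elim (a≢b refl)
  minimal (suc m) _    = s≤s z≤n

succ-flips-parity : ∀ {n i j} → parity n ≡ 0ℙ → Succ n i j → parity (toℕ j) ≡ parity (toℕ i) ⁻¹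
succ-flips-parity {i = i} _ (inj₁ j≡1+i) rewrite j≡1+i = ℙ.+-homo-+ 1 (toℕ i)
succ-flips-parity {i = i} n-even (inj₂ (1+i≡n , j≡0)) rewrite j≡0 =
  sym (trans (sym (ℙ.+-homo-+ 1 (toℕ i))) (trans (cong parity 1+i≡n) n-even))

cycle-bipartition : ∀ {n} → parity n ≡ 0ℙ → IsBipartition (Cycle n) (parity ∘ toℕ)
cycle-bipartition n-even (inj₁ s) = succ-flips-parity n-even s
cycle-bipartition n-even (inj₂ s) = sym (ℙ.⁻¹-selfInverse (sym (succ-flips-parity n-even s)))

x*2≡x+x : ∀ x → x * 2 ≡ x + x
x*2≡x+x = solve-∀

shortArc : ℕ → ℕ → ℕ
shortArc n a = a ⊓ (n ∸ a)

shortArc-complement : ∀ {n a b} → a + b ≡ n → shortArc n a ≡ a ⊓ b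
shortArc-complement {a = a} {b} refl = cong (a ⊓_) (m+n∸m≡n a b)

shortArc-mirror : ∀ {n a b} → a + b ≡ n → shortArc n a ≡ shortArc n b
shortArc-mirror {a = a} {b} a+b≡n = begin
  shortArc _ a ≡⟨ shortArc-complement a+b≡n ⟩
  a ⊓ b        ≡⟨ ⊓-comm a b ⟩
  b ⊓ a        ≡⟨ shortArc-complement (trans (+-comm b a) a+b≡n) ⟨
  shortArc _ b ∎
  where open ≡-Reasoning

shortArc-≡ : ∀ {n a x} → x * 2 ≤ n → a ≡ x ⊎ a + x ≡ n → shortArc n a ≡ x
shortArc-≡ {n} {x = x} 2x≤n (inj₁ refl) =
  m≤n⇒m⊓n≡m (m+n≤o⇒m≤o∸n x (subst (_≤ n) (x*2≡x+x x) 2x≤n))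
shortArc-≡ {n} {a} {x} 2x≤n (inj₂ a+x≡n) = trans (shortArc-complement a+x≡n) (m≥n⇒m⊓n≡n x≤a)
  where
  x≤a : x ≤ a
  x≤a = +-cancelʳ-≤ x x a (subst₂ _≤_ (x*2≡x+x x) (sym a+x≡n) 2x≤n)

WithinOne : ℕ → ℕ → Set
WithinOne a b = a ≤ suc b × b ≤ suc a

m∸n≤1+m∸[1+n] : ∀ m n → m ∸ n ≤ suc (m ∸ suc n)
m∸n≤1+m∸[1+n] zero    zero    = z≤n
m∸n≤1+m∸[1+n] zero    (suc n) = z≤n
m∸n≤1+m∸[1+n] (suc m) zero    = ≤-refl
m∸n≤1+m∸[1+n] (suc m) (suc n) = m∸n≤1+m∸[1+n] m n

shortArc-suc : ∀ n a → WithinOne (shortArc n a) (shortArc n (suc a))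
shortArc-suc n a = ⊓-mono-≤ (m≤n⇒m≤1+n (n≤1+n a)) (m∸n≤1+m∸[1+n] n a)
                 , ⊓-mono-≤ ≤-refl (≤-trans (∸-monoʳ-≤ n (n≤1+n a)) (n≤1+n _))

∣1+m-n∣-cases : ∀ m n → ∣ suc m - n ∣ ≡ suc ∣ m - n ∣ ⊎ ∣ m - n ∣ ≡ suc ∣ suc m - n ∣
∣1+m-n∣-cases zero    zero    = inj₁ refl
∣1+m-n∣-cases (suc m) zero    = inj₁ refl
∣1+m-n∣-cases zero    (suc n) = inj₂ refl
∣1+m-n∣-cases (suc m) (suc n) = ∣1+m-n∣-cases m n

shortArc-∣suc-∣ : ∀ n a k → WithinOne (shortArc n ∣ a - k ∣) (shortArc n ∣ suc a - k ∣)
shortArc-∣suc-∣ n a k with ∣1+m-n∣-cases a k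
... | inj₁ eq rewrite eq = shortArc-suc n ∣ a - k ∣
... | inj₂ eq rewrite eq = swap (shortArc-suc n ∣ suc a - k ∣)

module CycleDistance (M : ℕ) where
  private
    n = suc M
    C = Cycle n

  cycle-sym : ∀ {i j} → Adj C i j → Adj C j i
  cycle-sym (inj₁ s) = inj₂ s
  cycle-sym (inj₂ s) = inj₁ s

  forward : ∀ d (i j : Fin n) → toℕ j ≡ d + toℕ i → Walk C i j d
  forward zero    i j j≡i = subst (λ k → Walk C i k 0) (toℕ-injective (sym j≡i)) here
  forward (suc d) i j j≡d+1+i =
    step (inj₁ (inj₁ (toℕ-fromℕ< 1+i<n))) (forward d (fromℕ< 1+i<n) j j≡d+i′)
    where
    1+i<n : suc (toℕ i) < n
    1+i<n = ≤-<-trans (subst (suc (toℕ i) ≤_) (sym j≡d+1+i) (s≤s (m≤n+m (toℕ i) d))) (toℕ<n j)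
    j≡d+i′ : toℕ j ≡ d + toℕ (fromℕ< 1+i<n)
    j≡d+i′ = trans j≡d+1+i (trans (sym (+-suc d (toℕ i))) (cong (d +_) (sym (toℕ-fromℕ< 1+i<n))))

  around : (i j : Fin n) → Walk C j i ((M ∸ toℕ j) + suc (toℕ i))
  around i j = forward (M ∸ toℕ j) j (fromℕ M) toℕ-last
           ++ʷ step wrap (forward (toℕ i) fzero i (sym (+-identityʳ _)))
    where
    toℕ-last : toℕ (fromℕ M) ≡ (M ∸ toℕ j) + toℕ j
    toℕ-last = trans (toℕ-fromℕ M) (sym (m∸n+n≡m (s≤s⁻¹ (toℕ<n j))))
    wrap : Adj C (fromℕ M) fzero
    wrap = inj₁ (inj₂ (cong suc (toℕ-fromℕ M) , refl))

  walk-≤ : (i j : Fin n) → toℕ i ≤ toℕ j → Walk C i j (shortArc n (toℕ j ∸ toℕ i))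
  walk-≤ i j i≤j = subst (Walk C i j) (sym (shortArc-complement arcs)) (shorter (⊓-sel d e))
    where
    d = toℕ j ∸ toℕ i
    e = (M ∸ toℕ j) + suc (toℕ i)
    arcs : d + e ≡ n
    arcs = begin
      d + ((M ∸ toℕ j) + suc (toℕ i)) ≡⟨ lemma d (M ∸ toℕ j) (toℕ i) ⟩
      suc ((d + toℕ i) + (M ∸ toℕ j)) ≡⟨ cong (λ x → suc (x + (M ∸ toℕ j))) (m∸n+n≡m i≤j) ⟩
      suc (toℕ j + (M ∸ toℕ j))       ≡⟨ cong suc (m+[n∸m]≡n (s≤s⁻¹ (toℕ<n j))) ⟩
      n                               ∎
      where
      open ≡-Reasoning
      lemma : ∀ x y z → x + (y + suc z) ≡ suc ((x + z) + y)
      lemma = solve-∀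
    shorter : d ⊓ e ≡ d ⊎ d ⊓ e ≡ e → Walk C i j (d ⊓ e)
    shorter (inj₁ eq) = subst (Walk C i j) (sym eq) (forward d i j (sym (m∸n+n≡m i≤j)))
    shorter (inj₂ eq) = subst (Walk C i j) (sym eq) (reverseʷ cycle-sym (around i j))

  shortest-walk : (i j : Fin n) → Walk C i j (shortArc n ∣ toℕ i - toℕ j ∣)
  shortest-walk i j with ≤-total (toℕ i) (toℕ j)
  ... | inj₁ i≤j = subst (Walk C i j) (cong (shortArc n) (sym (m≤n⇒∣m-n∣≡n∸m i≤j)))
                         (walk-≤ i j i≤j)
  ... | inj₂ j≤i = subst (Walk C i j) (cong (shortArc n) (sym (m≤n⇒∣n-m∣≡n∸m j≤i)))
                         (reverseʷ cycle-sym (walk-≤ j i j≤i))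

  arcTo : Fin n → Fin n → ℕ
  arcTo k i = shortArc n ∣ toℕ i - toℕ k ∣

  arcTo-succ : ∀ k {i j} → Succ n i j → WithinOne (arcTo k i) (arcTo k j)
  arcTo-succ k {i} (inj₁ j≡1+i) rewrite j≡1+i = shortArc-∣suc-∣ n (toℕ i) (toℕ k)
  arcTo-succ k {i} (inj₂ (1+i≡n , j≡0)) rewrite j≡0 =
    subst (λ x → WithinOne x (shortArc n (toℕ k))) (sym last≡) (swap (shortArc-suc n (toℕ k)))
    where
    k≤i : toℕ k ≤ toℕ i
    k≤i = s≤s⁻¹ (subst (toℕ k <_) (sym 1+i≡n) (toℕ<n k))
    last≡ : arcTo k i ≡ shortArc n (suc (toℕ k))
    last≡ = trans (cong (shortArc n) (m≤n⇒∣n-m∣≡n∸m k≤i))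
                  (shortArc-mirror (trans (+-suc _ (toℕ k)) (trans (cong suc (m∸n+n≡m k≤i)) 1+i≡n)))

  cycle-distance : (i j : Fin n) → Dist C i j (shortArc n ∣ toℕ i - toℕ j ∣)
  cycle-distance i j = shortest-walk i j , minimal
    where
    lipschitz : ∀ {u v} → Adj C u v → arcTo j u ≤ suc (arcTo j v)
    lipschitz (inj₁ s) = proj₁ (arcTo-succ j s)
    lipschitz (inj₂ s) = proj₂ (arcTo-succ j s)
    minimal : ∀ m → Walk C i j m → arcTo j i ≤ m
    minimal m p = subst (arcTo j i ≤_)
                        (trans (cong (λ x → m + shortArc n x) (∣n-n∣≡0 (toℕ j))) (+-identityʳ m))
                        (walk-length-≥ (arcTo j) lipschitz p)

⌊1+n*2/2⌋≡⌊n*2/2⌋ : ∀ n → ⌊ suc (n * 2) /2⌋ ≡ ⌊ n * 2 /2⌋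
⌊1+n*2/2⌋≡⌊n*2/2⌋ zero    = refl
⌊1+n*2/2⌋≡⌊n*2/2⌋ (suc n) = cong suc (⌊1+n*2/2⌋≡⌊n*2/2⌋ n)

odd-between : ∀ {c d} → c ≤ d → d ≤ suc c → parity d ≡ 1ℙ → d ≡ suc (⌊ c /2⌋ * 2)
odd-between {0}           {0}           _ _ ()
odd-between {0}           {1}           _ _ _ = refl
odd-between {0}           {suc (suc d)} _ (s≤s ()) _
odd-between {1}           {0}           () _ _
odd-between {1}           {1}           _ _ _ = refl
odd-between {1}           {2}           _ _ ()
odd-between {1}           {suc (suc (suc d))} _ (s≤s (s≤s ())) _
odd-between {suc (suc c)} {0}           () _ _
odd-between {suc (suc c)} {1}           (s≤s ()) _ _
odd-between {suc (suc c)} {suc (suc d)} (s≤s (s≤s c≤d)) (s≤s (s≤s d≤1+c)) odd =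
  cong (suc ∘ suc) (odd-between c≤d d≤1+c odd)

halve : ∀ n → ∃[ h ] (n ≡ h * 2 ⊎ n ≡ suc (h * 2))
halve zero = 0 , inj₁ refl
halve (suc n) with halve n
... | h , inj₁ refl = h , inj₂ refl
... | h , inj₂ refl = suc h , inj₁ refl

∣-∣-offset : ∀ {x y} d → x + d ≡ y → ∣ x - y ∣ ≡ d
∣-∣-offset {x} d refl = ∣m-m+n∣≡n x d

∣-∣-offset′ : ∀ {x y} d → x + d ≡ y → ∣ y - x ∣ ≡ d
∣-∣-offset′ {x} {y} d x+d≡y = trans (∣-∣-comm y x) (∣-∣-offset d x+d≡y)

halves-match : ∀ {n a b} s → suc (s * 2) * 2 ≤ n →
               a ≡ s * 2 ⊎ a + s * 2 ≡ n → b ≡ suc (s * 2) ⊎ b + suc (s * 2) ≡ n →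
               ⌊ shortArc n a /2⌋ ≡ ⌊ shortArc n b /2⌋
halves-match s bound a-arc b-arc = begin
  ⌊ shortArc _ _ /2⌋ ≡⟨ cong ⌊_/2⌋ (shortArc-≡ 2s*2≤n a-arc) ⟩
  ⌊ s * 2 /2⌋        ≡⟨ ⌊1+n*2/2⌋≡⌊n*2/2⌋ s ⟨
  ⌊ suc (s * 2) /2⌋  ≡⟨ cong ⌊_/2⌋ (shortArc-≡ bound b-arc) ⟨
  ⌊ shortArc _ _ /2⌋ ∎
  where
  open ≡-Reasoning
  2s*2≤n : s * 2 * 2 ≤ _
  2s*2≤n = ≤-trans (*-monoˡ-≤ 2 (n≤1+n (s * 2))) bound

Equalizes : ℕ → ℕ → ℕ → ℕ → Set
Equalizes n I J K = K < n × ⌊ shortArc n ∣ I - K ∣ /2⌋ ≡ ⌊ shortArc n ∣ J - K ∣ /2⌋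

offset-even : ∀ {n} h I → I + h * 2 < n → ∃[ K ] Equalizes n I (I + h * 2) K
offset-even h I lt = I + h , ≤-<-trans (+-monoʳ-≤ I (m≤m*n h 2)) lt
                   , cong (⌊_/2⌋ ∘ shortArc _) (trans (∣-∣-offset {I} h refl) (sym (∣-∣-offset′ h eq)))
  where
  eq : (I + h) + h ≡ I + h * 2
  eq = solve (I ∷ h ∷ [])

offset-4t+1 : ∀ {n} t I → I + suc (t * 2 * 2) < n → ∃[ K ] Equalizes n I (I + suc (t * 2 * 2)) K
offset-4t+1 t I lt = I + t * 2 , ≤-<-trans (+-monoʳ-≤ I (m≤n⇒m≤1+n (m≤m*n (t * 2) 2))) lt
                , halves-match t (≤-trans (s≤s (m≤n+m _ I)) lt)
                    (inj₁ (∣-∣-offset {I} (t * 2) refl)) (inj₁ (∣-∣-offset′ (suc (t * 2)) eq))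
  where
  eq : (I + t * 2) + suc (t * 2) ≡ I + suc (t * 2 * 2)
  eq = solve (I ∷ t ∷ [])

-- K lies on the long arc from I + e round to I, 2s steps after I + e and 2s + 1 steps before I.
offset-long : ∀ {n e} s I → 1 ≤ e → e + suc (s * 2 * 2) ≡ n → I + e < n → ∃[ K ] Equalizes n I (I + e) K
offset-long {n} {e} s I 1≤e long lt = near-or-far (I ≤? s * 2)
  where
  bound : suc (s * 2) * 2 ≤ n
  bound = ≤-trans (+-monoˡ-≤ (suc (s * 2 * 2)) 1≤e) (≤-reflexive long)
  near-or-far : Dec (I ≤ s * 2) → ∃[ K ] Equalizes n I (I + e) K
  near-or-far (yes I≤2s) = (I + e) + s * 2 , K<n
                         , sym (halves-match s bound (inj₁ (∣-∣-offset {I + e} (s * 2) refl)) (inj₂ arcI))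
    where
    K<n : suc ((I + e) + s * 2) ≤ n
    K<n = ≤-trans (s≤s (+-monoˡ-≤ (s * 2) (+-monoˡ-≤ e I≤2s))) (≤-reflexive (trans rearrange long))
      where
      rearrange : suc ((s * 2 + e) + s * 2) ≡ e + suc (s * 2 * 2)
      rearrange = solve (s ∷ e ∷ [])
    arcI : ∣ I - (I + e) + s * 2 ∣ + suc (s * 2) ≡ n
    arcI = trans (cong (_+ suc (s * 2)) (∣-∣-offset {I} (e + s * 2) (sym (+-assoc I e (s * 2)))))
                 (trans rearrange long)
      where
      rearrange : (e + s * 2) + suc (s * 2) ≡ e + suc (s * 2 * 2)
      rearrange = solve (s ∷ e ∷ [])
  near-or-far (no I≰2s) with m≤n⇒∃[o]m+o≡n (≰⇒> I≰2s)
  ... | K , 1+2s+K≡I = K , K<n , sym (halves-match s bound (inj₂ arcJ) (inj₁ arcI))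
    where
    K+1+2s≡I : K + suc (s * 2) ≡ I
    K+1+2s≡I = trans (+-comm K _) 1+2s+K≡I
    K<n : K < n
    K<n = ≤-<-trans (≤-trans (m≤n+m K (suc (s * 2))) (≤-trans (≤-reflexive 1+2s+K≡I) (m≤m+n I e))) lt
    arcI : ∣ I - K ∣ ≡ suc (s * 2)
    arcI = ∣-∣-offset′ (suc (s * 2)) K+1+2s≡I
    arcJ : ∣ I + e - K ∣ + s * 2 ≡ n
    arcJ = trans (cong (_+ s * 2) (∣-∣-offset′ (suc (s * 2) + e)
                   (trans (sym (+-assoc K _ e)) (cong (_+ e) K+1+2s≡I))))
                 (trans rearrange long)
      where
      rearrange : (suc (s * 2) + e) + s * 2 ≡ e + suc (s * 2 * 2)
      rearrange = solve (s ∷ e ∷ [])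

4t+3<4q⇒t<q : ∀ t q → suc (suc (t * 2) * 2) < q * 4 → t < q
4t+3<4q⇒t<q t q lt = *-cancelʳ-≤ (suc t) q 4 (≤-trans (≤-reflexive 4[t+1]≡) lt)
  where
  4[t+1]≡ : suc t * 4 ≡ suc (suc (suc (t * 2) * 2))
  4[t+1]≡ = solve (t ∷ [])

[4t+3]+[4s+1]≡4[t+1+s] : ∀ t s → suc (suc (t * 2) * 2) + suc (s * 2 * 2) ≡ (suc t + s) * 4
[4t+3]+[4s+1]≡4[t+1+s] = solve-∀

equalizing-offset : ∀ q I e → I + e < q * 4 → ∃[ K ] Equalizes (q * 4) I (I + e) K
equalizing-offset q I e lt with halve e
... | h , inj₁ refl = offset-even h I lt
... | h , inj₂ refl with halve h
...   | t , inj₁ refl = offset-4t+1 t I lt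
...   | t , inj₂ refl with m≤n⇒∃[o]m+o≡n (4t+3<4q⇒t<q t q (≤-trans (s≤s (m≤n+m _ I)) lt))
...     | s , refl = offset-long s I (s≤s z≤n) ([4t+3]+[4s+1]≡4[t+1+s] t s) lt

equalizing-position-≤ : ∀ q {I J} → I ≤ J → J < q * 4 → ∃[ K ] Equalizes (q * 4) I J K
equalizing-position-≤ q {I} I≤J J<n =
  subst (λ J → ∃[ K ] Equalizes (q * 4) I J K) (m+[n∸m]≡n I≤J)
        (equalizing-offset q I _ (subst (_< q * 4) (sym (m+[n∸m]≡n I≤J)) J<n))

equalizing-position : ∀ {n I J} → 4 ∣ n → I < n → J < n → ∃[ K ] Equalizes n I J K
equalizing-position {I = I} {J} (divides q refl) I<n J<n with ≤-total I J
... | inj₁ I≤J = equalizing-position-≤ q I≤J J<n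
... | inj₂ J≤I with equalizing-position-≤ q J≤I I<n
...   | K , K<n , halves≡ = K , K<n , sym halves≡

covers-fibres⇒n≤length : ∀ {n} {B : Set} (D : List (Fin n × B)) →
                         (∀ i → ∃[ b ] (i , b) ∈ D) → n ≤ length D
covers-fibres⇒n≤length D cover = injective⇒≤ {f = position} injective
  where
  position : Fin _ → Fin (length D)
  position i = index (proj₂ (cover i))
  injective : ∀ {i j} → position i ≡ position j → i ≡ j
  injective {i} {j} eq = cong proj₁ (begin
    (i , _)                       ≡⟨ lookup-index (proj₂ (cover i)) ⟩
    lookup D (position i)         ≡⟨ cong (lookup D) eq ⟩
    lookup D (position j)         ≡⟨ lookup-index (proj₂ (cover j)) ⟨
    (j , _)                       ∎)
    where open ≡-Reasoning

bit : Parity → Fin 2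
bit 0ℙ = fzero
bit 1ℙ = fsuc fzero

parity-bit : ∀ p → parity (toℕ (bit p)) ≡ p
parity-bit 0ℙ = refl
parity-bit 1ℙ = refl

bit-parity : ∀ a → bit (parity (toℕ a)) ≡ a
bit-parity fzero        = refl
bit-parity (fsuc fzero) = refl

p+[p+q]≡q : ∀ p q → p ⊕ (p ⊕ q) ≡ q
p+[p+q]≡q 0ℙ q  = refl
p+[p+q]≡q 1ℙ 0ℙ = refl
p+[p+q]≡q 1ℙ 1ℙ = refl

4∣n⇒even : ∀ {n} → 4 ∣ n → parity n ≡ 0ℙ
4∣n⇒even (divides q refl) = trans (ℙ.*-homo-* q 4) (ℙ.*-zeroʳ (parity q))

module Prism (M : ℕ) (n-even : parity (suc M) ≡ 0ℙ) where
  open CycleDistance M using (cycle-distance)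

  private
    n = suc M

  P : Graph
  P = Cycle n □ K2

  side : V P → Parity
  side v = parity (toℕ (proj₁ v)) ⊕ parity (toℕ (proj₂ v))

  bipartition : IsBipartition P side
  bipartition = □-bipartition {Cycle n} {K2} (parity ∘ toℕ) (parity ∘ toℕ)
                              (cycle-bipartition n-even) K2-bipartition

  layer : Parity → Fin n → V P
  layer c i = i , bit (parity (toℕ i) ⊕ c)

  side-layer : ∀ c i → side (layer c i) ≡ c
  side-layer c i = trans (cong (parity (toℕ i) ⊕_) (parity-bit _)) (p+[p+q]≡q (parity (toℕ i)) c)

  layer-side : ∀ v → layer (side v) (proj₁ v) ≡ v
  layer-side (i , a) = cong (i ,_) (trans (cong bit (p+[p+q]≡q (parity (toℕ i)) _)) (bit-parity a))

  checkerboard : List (V P)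
  checkerboard = map (layer 0ℙ) (allFin n)

  checkerboard-unique : Unique checkerboard
  checkerboard-unique = map⁺ (cong proj₁) (allFin⁺ n)

  checkerboard-length : length checkerboard ≡ n
  checkerboard-length = trans (length-map (layer 0ℙ) (allFin n)) (length-tabulate (λ i → i))

  layer0∈checkerboard : ∀ i → layer 0ℙ i ∈ checkerboard
  layer0∈checkerboard i = ∈-map⁺ (layer 0ℙ) (∈-allFin i)

  outside-checkerboard : ∀ {v} → v ∉ checkerboard → layer 1ℙ (proj₁ v) ≡ v
  outside-checkerboard {v} v∉ with side v | layer-side v
  ... | 0ℙ | refl = ⊥-elim (v∉ (layer0∈checkerboard (proj₁ v)))
  ... | 1ℙ | eq   = eq

  halfArc : Fin n → Fin n → ℕ
  halfArc i k = ⌊ shortArc n ∣ toℕ i - toℕ k ∣ /2⌋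

  outsider-distance : ∀ i k → ∃[ d ] Dist P (layer 1ℙ i) (layer 0ℙ k) d × d ≡ suc (halfArc i k * 2)
  outsider-distance i k with K2-distance (proj₂ (layer 1ℙ i)) (proj₂ (layer 0ℙ k))
  ... | b , b≤1 , dist₂ = c + b , dist , odd-between (m≤m+n c b) c+b≤1+c odd
    where
    c = shortArc n ∣ toℕ i - toℕ k ∣
    dist = Dist-□ (cycle-distance i k) dist₂
    c+b≤1+c : c + b ≤ suc c
    c+b≤1+c = ≤-trans (+-monoʳ-≤ c b≤1) (≤-reflexive (+-comm c 1))
    odd : parity (c + b) ≡ 1ℙ
    odd = trans (walk-parity bipartition (proj₁ dist)) (cong₂ _⊕_ (side-layer 1ℙ i) (side-layer 0ℙ k))

  equalizing-vertex : 4 ∣ n → ∀ i j → ∃[ k ] halfArc i k ≡ halfArc j k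
  equalizing-vertex 4∣n i j with equalizing-position 4∣n (toℕ<n i) (toℕ<n j)
  ... | K , K<n , halves≡ =
    fromℕ< K<n , proj₂ (subst (Equalizes n (toℕ i) (toℕ j)) (sym (toℕ-fromℕ< K<n)) (K<n , halves≡))

  checkerboard-equalizer : 4 ∣ n → IsDistanceEqualizer P checkerboard
  checkerboard-equalizer 4∣n x y x∉ y∉ _ with outside-checkerboard x∉ | outside-checkerboard y∉
  ... | refl | refl with equalizing-vertex 4∣n (proj₁ x) (proj₁ y)
  ... | k , halves≡ with outsider-distance (proj₁ x) k | outsider-distance (proj₁ y) k
  ... | d , dist-x , d≡ | d′ , dist-y , d′≡ =
    layer 0ℙ k , layer0∈checkerboard k , d , dist-x , subst (Dist P _ _) d′≡d dist-y
    where
    d′≡d : d′ ≡ d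
    d′≡d = trans d′≡ (trans (cong (λ h → suc (h * 2)) (sym halves≡)) (sym d≡))

  equalizer-length-≥ : ∀ D → IsDistanceEqualizer P D → n ≤ length D
  equalizer-length-≥ D equalizer = covers-fibres⇒n≤length D rung-met
    where
    rung-met : ∀ i → ∃[ a ] (i , a) ∈ D
    rung-met i with equalizer-meets-edge bipartition (≡-dec _≟ᶠ_ _≟ᶠ_) equalizer
                                          {i , fzero} {i , fsuc fzero} (inj₁ (refl , λ ()))
    ... | inj₁ ∈D = fzero , ∈D
    ... | inj₂ ∈D = fsuc fzero , ∈D

mainTheorem10 : (n : ℕ) → 4 ≤ n → n % 4 ≡ 0 →
    EquidistantDimension (Cycle n □ K2) n
mainTheorem10 zero    ()
mainTheorem10 (suc M) _ n%4≡0 =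
  (checkerboard , checkerboard-unique , checkerboard-equalizer 4∣n , checkerboard-length) ,
  λ D _ → equalizer-length-≥ D
  where
  4∣n : 4 ∣ suc M
  4∣n = m%n≡0⇒n∣m (suc M) 4 n%4≡0
  open Prism M (4∣n⇒even 4∣n)
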